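{- If $G$ is a split graph on $n$ vertices, then $\chi_{rs}(G)=n-\alpha(G)+1$.
   Context: All graphs are finite, simple and undirected. A split graph is a graph whose vertex set can be partitioned into a clique and an independent set. $\alpha(G)$ is the independence number of $G$. For $k\in\mathbb{N}$, a $k$-restricted star colouring ($k$-rs colouring) of $G$ is a map $f:V(G)\to\{0,\dots,k-1\}$ with $f(x)\neq f(y)$ for every edge $xy$ and with no path $x,y,z$ in $G$ (not necessarily induced) such that $f(y)>f(x)=f(z)$. $\chi_{rs}(G)$ is the least $k$ such that $G$ admits a $k$-rs colouring. -}

module Defs where

open import Data.Nat using (ℕ; _≤_; _<_)
open import Data.Fin using (Fin; toℕ)
open import Data.Fin.Subset using (Subset; _∈_; ∣_∣)
open import Data.Product using (Σ; _×_; ∃)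
open import Data.Sum using (_⊎_)
open import Data.Empty using (⊥)
open import Relation.Nullary using (¬_)
open import Relation.Binary.PropositionalEquality using (_≡_; _≢_)

record Graph (n : ℕ) : Set₁ where
  field
    Adj     : Fin n → Fin n → Set
    sym     : ∀ {x y} → Adj x y → Adj y x
    irrefl  : ∀ {x} → ¬ Adj x x

open Graph public

IsClique : ∀ {n} → Graph n → Subset n → Set
IsClique G S = ∀ x y → x ∈ S → y ∈ S → x ≢ y → Adj G x y

IsIndependent : ∀ {n} → Graph n → Subset n → Set
IsIndependent G S = ∀ x y → x ∈ S → y ∈ S → ¬ Adj G x y

IsSplit : ∀ {n} → Graph n → Set
IsSplit {n} G = Σ (Subset n) λ K → Σ (Subset n) λ I →
  IsClique G K × IsIndependent G I ×
  (∀ x → (x ∈ K ⊎ x ∈ I)) × (∀ x → x ∈ K → x ∈ I → ⊥)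

IsIndependenceNumber : ∀ {n} → Graph n → ℕ → Set
IsIndependenceNumber {n} G a =
  (Σ (Subset n) λ S → IsIndependent G S × ∣ S ∣ ≡ a) ×
  (∀ S → IsIndependent G S → ∣ S ∣ ≤ a)

-- k-restricted star colouring: a proper colouring f : V → {0,…,k-1} with no
-- path x,y,z (not necessarily induced; x ≠ z) with f(y) > f(x) = f(z).
IsRSColouring : ∀ {n} → Graph n → (k : ℕ) → (Fin n → Fin k) → Set
IsRSColouring {n} G k f =
  (∀ x y → Adj G x y → f x ≢ f y) ×
  (∀ x y z → Adj G x y → Adj G y z → x ≢ z →
     ¬ (toℕ (f x) < toℕ (f y) × f x ≡ f z))

HasRSColouring : ∀ {n} → Graph n → ℕ → Set
HasRSColouring {n} G k = Σ (Fin n → Fin k) λ f → IsRSColouring G k f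

IsRSChromaticNumber : ∀ {n} → Graph n → ℕ → Set
IsRSChromaticNumber G c = HasRSColouring G c × (∀ k → k < c → ¬ HasRSColouring G k)

-- Colour the vertices outside a maximum independent set S with distinct colours
-- 0, …, n − α − 1 and all of S with the top colour n − α: two vertices of equal colour lie in S,
-- so no path between them has a larger colour in the middle; hence χ_rs ≤ n − α + 1.
-- Conversely, let (K, I) split G and let f be a k-rs colouring. The clique K is coloured
-- injectively. If some v ∈ I has a colour unused on K, then K ∪ {v} is coloured injectively and
-- k > |K|. Otherwise the vertex w of K of largest colour has no neighbour v ∈ I: v shares its
-- colour with some u ∈ K, and v, w, u would be a path with f(w) > f(v) = f(u). Then I ∪ {w} is
-- independent, so α > |I|. Either way k ≥ n − α + 1.
module Submission where

open import Defs
open import Data.Nat using (ℕ; suc; _+_; _∸_; _≤_; _<_; z≤n; s≤s; s≤s⁻¹)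
open import Data.Nat.Properties
  using (≤-refl; ≤-trans; <-≤-trans; ≤-<-trans; <⇒≤; ≰⇒>; _≤?_; <⇒≱; ≤⇒≯; ≤∧≢⇒<; +-comm;
         ∸-monoʳ-≤; ∸-monoʳ-<)
open import Data.Fin using (Fin; zero; suc; toℕ; fromℕ; fromℕ<; inject₁)
open import Data.Fin.Properties
  using (_≟_; any?; 0≢1+n; suc-injective; toℕ-injective; toℕ-fromℕ; toℕ≤pred[n]; fromℕ≢inject₁;
         inject₁-injective)
open import Data.Fin.Subset
  using (Subset; inside; outside; _∈_; _∉_; ∣_∣; ⊤; ∁; _∪_; ⁅_⁆; _-_; Nonempty)
open import Data.Fin.Subset.Properties
  using (_∈?_; ∈⊤; ∣⊤∣≡n; ∣p∣≤n; ∣∁p∣≡n∸∣p∣; x∉p⇒x∈∁p; x∈∁p⇒x∉p; p⊆q⇒∣p∣≤∣q∣; p⊂q⇒∣p∣<∣q∣;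
         p⊆p∪q; x∈p∪q⁺; x∈p∪q⁻; x∈⁅x⁆; x∈⁅y⁆⇒x≡y; x∈p∧x≢y⇒x∈p-y; x∈p⇒∣p-x∣<∣p∣)
open import Data.Bool using (Bool)
open import Data.Vec using ([]; _∷_; here; there)
open import Data.Product using (∃; _×_; _,_; proj₁)
open import Data.Sum using (_⊎_; inj₁; inj₂)
open import Data.Empty using (⊥; ⊥-elim)
open import Function using (_∘_)
open import Relation.Nullary using (¬_; Dec; yes; no; ¬?; contradiction)
open import Relation.Nullary.Decidable using (_×-dec_)
open import Relation.Binary.PropositionalEquality using (_≡_; _≢_; refl; trans; cong; subst)
  renaming (sym to ≡-sym)

private
  variable
    m n k : ℕ

InjectiveOn : {A : Set} → (Fin n → A) → Subset n → Set
InjectiveOn f p = ∀ {x y} → x ∈ p → y ∈ p → f x ≡ f y → x ≡ y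

injectiveOn-tail : {A : Set} {f : Fin (suc n) → A} {b : Bool} {p : Subset n} →
  InjectiveOn f (b ∷ p) → InjectiveOn (f ∘ suc) p
injectiveOn-tail inj x∈p y∈p e = suc-injective (inj (there x∈p) (there y∈p) e)

injectiveOn⇒∣p∣≤∣q∣ : (f : Fin m → Fin n) (p : Subset m) (q : Subset n) →
  (∀ {x} → x ∈ p → f x ∈ q) → InjectiveOn f p → ∣ p ∣ ≤ ∣ q ∣
injectiveOn⇒∣p∣≤∣q∣ f [] q _ _ = z≤n
injectiveOn⇒∣p∣≤∣q∣ f (outside ∷ p) q maps inj =
  injectiveOn⇒∣p∣≤∣q∣ (f ∘ suc) p q (maps ∘ there) (injectiveOn-tail inj)
injectiveOn⇒∣p∣≤∣q∣ f (inside ∷ p) q maps inj =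
  ≤-trans (s≤s (injectiveOn⇒∣p∣≤∣q∣ (f ∘ suc) p (q - f zero) maps′ (injectiveOn-tail inj)))
          (x∈p⇒∣p-x∣<∣p∣ (maps here))
  where
  maps′ : ∀ {x} → x ∈ p → f (suc x) ∈ q - f zero
  maps′ x∈p = x∈p∧x≢y⇒x∈p-y (maps (there x∈p)) λ e → 0≢1+n (≡-sym (inj (there x∈p) here e))

injectiveOn⇒∣p∣≤n : (f : Fin m → Fin n) (p : Subset m) → InjectiveOn f p → ∣ p ∣ ≤ n
injectiveOn⇒∣p∣≤n {n = n} f p inj =
  subst (∣ p ∣ ≤_) (∣⊤∣≡n n) (injectiveOn⇒∣p∣≤∣q∣ f p ⊤ (λ _ → ∈⊤) inj)

rank : (p : Subset n) {x : Fin n} → x ∈ p → Fin ∣ p ∣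
rank (inside ∷ p) here = zero
rank (inside ∷ p) (there x∈p) = suc (rank p x∈p)
rank (outside ∷ p) (there x∈p) = rank p x∈p

rank-injective : (p : Subset n) {x y : Fin n} (x∈p : x ∈ p) (y∈p : y ∈ p) →
  rank p x∈p ≡ rank p y∈p → x ≡ y
rank-injective (inside ∷ p) here here _ = refl
rank-injective (inside ∷ p) (there x∈p) (there y∈p) e =
  cong suc (rank-injective p x∈p y∈p (suc-injective e))
rank-injective (outside ∷ p) (there x∈p) (there y∈p) e = cong suc (rank-injective p x∈p y∈p e)

∉⊎argmax : (g : Fin n → ℕ) (p : Subset n) →
  (∀ {x} → x ∉ p) ⊎ ∃ λ w → w ∈ p × (∀ {x} → x ∈ p → g x ≤ g w)
∉⊎argmax g [] = inj₁ λ ()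
∉⊎argmax g (b ∷ p) with ∉⊎argmax (g ∘ suc) p
∉⊎argmax g (outside ∷ p) | inj₁ ∉p = inj₁ λ { (there x∈p) → ∉p x∈p }
∉⊎argmax g (inside ∷ p)  | inj₁ ∉p =
  inj₂ (zero , here , λ { here → ≤-refl ; (there x∈p) → ⊥-elim (∉p x∈p) })
∉⊎argmax g (outside ∷ p) | inj₂ (w , w∈p , max) =
  inj₂ (suc w , there w∈p , λ { (there x∈p) → max x∈p })
∉⊎argmax g (inside ∷ p)  | inj₂ (w , w∈p , max) with g zero ≤? g (suc w)
... | yes g0≤ = inj₂ (suc w , there w∈p , λ { here → g0≤ ; (there x∈p) → max x∈p })
... | no g0≰ =
  inj₂ (zero , here , λ { here → ≤-refl ; (there x∈p) → ≤-trans (max x∈p) (<⇒≤ (≰⇒> g0≰)) })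

argmax : (g : Fin n → ℕ) {p : Subset n} → Nonempty p → ∃ λ w → w ∈ p × (∀ {x} → x ∈ p → g x ≤ g w)
argmax g {p} (x , x∈p) with ∉⊎argmax g p
... | inj₁ ∉p = ⊥-elim (∉p x∈p)
... | inj₂ max = max

∣p∣<∣p∪⁅x⁆∣ : {p : Subset n} {x : Fin n} → x ∉ p → ∣ p ∣ < ∣ p ∪ ⁅ x ⁆ ∣
∣p∣<∣p∪⁅x⁆∣ {x = x} x∉p = p⊂q⇒∣p∣<∣q∣ (p⊆p∪q ⁅ x ⁆ , x , x∈p∪q⁺ (inj₂ (x∈⁅x⁆ x)) , x∉p)

x∈p∪⁅y⁆⁻ : {p : Subset n} {x y : Fin n} → x ∈ p ∪ ⁅ y ⁆ → x ∈ p ⊎ x ≡ y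
x∈p∪⁅y⁆⁻ {p = p} {y = y} x∈ with x∈p∪q⁻ p ⁅ y ⁆ x∈
... | inj₁ x∈p = inj₁ x∈p
... | inj₂ x∈⁅y⁆ = inj₂ (x∈⁅y⁆⇒x≡y y x∈⁅y⁆)

n∸∣q∣≤∣p∣ : {p q : Subset n} → (∀ x → x ∈ p ⊎ x ∈ q) → n ∸ ∣ q ∣ ≤ ∣ p ∣
n∸∣q∣≤∣p∣ {p = p} {q} cover = subst (_≤ ∣ p ∣) (∣∁p∣≡n∸∣p∣ q) (p⊆q⇒∣p∣≤∣q∣ ∁q⊆p)
  where
  ∁q⊆p : ∀ {x} → x ∈ ∁ q → x ∈ p
  ∁q⊆p {x} x∈∁q with cover x
  ... | inj₁ x∈p = x∈p
  ... | inj₂ x∈q = contradiction x∈q (x∈∁p⇒x∉p x∈∁q)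

injectiveOn-∪⁅x⁆ : {A : Set} {f : Fin n → A} {p : Subset n} {x : Fin n} →
  InjectiveOn f p → (∀ {u} → u ∈ p → f u ≢ f x) → InjectiveOn f (p ∪ ⁅ x ⁆)
injectiveOn-∪⁅x⁆ inj fresh u∈ v∈ e with x∈p∪⁅y⁆⁻ u∈ | x∈p∪⁅y⁆⁻ v∈
... | inj₁ u∈p | inj₁ v∈p = inj u∈p v∈p e
... | inj₁ u∈p | inj₂ refl = contradiction e (fresh u∈p)
... | inj₂ refl | inj₁ v∈p = contradiction (≡-sym e) (fresh v∈p)
... | inj₂ refl | inj₂ refl = refl

independent-∪⁅x⁆ : (G : Graph n) {p : Subset n} {x : Fin n} →
  IsIndependent G p → (∀ v → v ∈ p → ¬ Adj G x v) → IsIndependent G (p ∪ ⁅ x ⁆)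
independent-∪⁅x⁆ G indep x≁p u v u∈ v∈ with x∈p∪⁅y⁆⁻ u∈ | x∈p∪⁅y⁆⁻ v∈
... | inj₁ u∈p | inj₁ v∈p = indep u v u∈p v∈p
... | inj₁ u∈p | inj₂ refl = x≁p u u∈p ∘ sym G
... | inj₂ refl | inj₁ v∈p = x≁p v v∈p
... | inj₂ refl | inj₂ refl = irrefl G

clique-injectiveOn : {A : Set} (G : Graph n) {K : Subset n} {f : Fin n → A} → IsClique G K →
  (∀ x y → Adj G x y → f x ≢ f y) → InjectiveOn f K
clique-injectiveOn G clique proper {x} {y} x∈K y∈K e with x ≟ y
... | yes x≡y = x≡y
... | no x≢y = contradiction e (proper x y (clique x y x∈K y∈K x≢y))

topColour : (S : Subset n) {x : Fin n} → Dec (x ∈ S) → Fin (suc ∣ ∁ S ∣)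
topColour S (yes _) = fromℕ ∣ ∁ S ∣
topColour S (no x∉S) = inject₁ (rank (∁ S) (x∉p⇒x∈∁p x∉S))

topColour-∈ : (S : Subset n) {x : Fin n} (x∈S? : Dec (x ∈ S)) → x ∈ S →
  topColour S x∈S? ≡ fromℕ ∣ ∁ S ∣
topColour-∈ S (yes _) _ = refl
topColour-∈ S (no x∉S) x∈S = contradiction x∈S x∉S

topColour-≡ : (S : Subset n) {x y : Fin n} (x∈S? : Dec (x ∈ S)) (y∈S? : Dec (y ∈ S)) →
  topColour S x∈S? ≡ topColour S y∈S? → x ≡ y ⊎ (x ∈ S × y ∈ S)
topColour-≡ S (yes x∈S) (yes y∈S) _ = inj₂ (x∈S , y∈S)
topColour-≡ S (yes _) (no _) e = contradiction e fromℕ≢inject₁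
topColour-≡ S (no _) (yes _) e = contradiction (≡-sym e) fromℕ≢inject₁
topColour-≡ S (no x∉S) (no y∉S) e =
  inj₁ (rank-injective (∁ S) (x∉p⇒x∈∁p x∉S) (x∉p⇒x∈∁p y∉S) (inject₁-injective e))

independent⇒rsColouring : (G : Graph n) {S : Subset n} → IsIndependent G S →
  HasRSColouring G (∣ ∁ S ∣ + 1)
independent⇒rsColouring G {S} indep = subst (HasRSColouring G) (+-comm 1 ∣ ∁ S ∣) (f , proper , rs)
  where
  f : Fin _ → Fin (suc ∣ ∁ S ∣)
  f x = topColour S (x ∈? S)

  f-≡ : ∀ {x y} → f x ≡ f y → x ≡ y ⊎ (x ∈ S × y ∈ S)
  f-≡ {x} {y} = topColour-≡ S (x ∈? S) (y ∈? S)

  proper : ∀ x y → Adj G x y → f x ≢ f y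
  proper x y x~y e with f-≡ {x} {y} e
  ... | inj₁ refl = irrefl G x~y
  ... | inj₂ (x∈S , y∈S) = indep x y x∈S y∈S x~y

  rs : ∀ x y z → Adj G x y → Adj G y z → x ≢ z → ¬ (toℕ (f x) < toℕ (f y) × f x ≡ f z)
  rs x y z _ _ x≢z (fx<fy , fx≡fz) with f-≡ {x} {z} fx≡fz
  ... | inj₁ x≡z = x≢z x≡z
  ... | inj₂ (x∈S , _) = ≤⇒≯ (toℕ≤pred[n] (f y)) (subst (_< toℕ (f y)) toℕ[fx]≡top fx<fy)
    where
    toℕ[fx]≡top : toℕ (f x) ≡ ∣ ∁ S ∣
    toℕ[fx]≡top = trans (cong toℕ (topColour-∈ S (x ∈? S) x∈S)) (toℕ-fromℕ _)

fresh-colour⇒∣K∣<k : (G : Graph n) {K : Subset n} {f : Fin n → Fin k} {v : Fin n} →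
  IsClique G K → (∀ x y → Adj G x y → f x ≢ f y) →
  v ∉ K → (∀ {u} → u ∈ K → f u ≢ f v) → ∣ K ∣ < k
fresh-colour⇒∣K∣<k G {K} {f} {v} clique proper v∉K fresh =
  <-≤-trans (∣p∣<∣p∪⁅x⁆∣ v∉K)
    (injectiveOn⇒∣p∣≤n f (K ∪ ⁅ v ⁆) (injectiveOn-∪⁅x⁆ (clique-injectiveOn G clique proper) fresh))

maxColour-nonadjacent : (G : Graph n) {K : Subset n} {f : Fin n → Fin k} {w u v : Fin n} →
  IsClique G K → IsRSColouring G k f →
  w ∈ K → (∀ {x} → x ∈ K → toℕ (f x) ≤ toℕ (f w)) →
  u ∈ K → v ∉ K → f u ≡ f v → ¬ Adj G w v
maxColour-nonadjacent G {f = f} {w} {u} {v} clique (proper , rs) w∈K max u∈K v∉K fu≡fv w~v =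
  rs v w u (sym G w~v) (clique w u w∈K u∈K w≢u) v≢u (fv<fw , ≡-sym fu≡fv)
  where
  fw≢fv : f w ≢ f v
  fw≢fv = proper w v w~v
  w≢u : w ≢ u
  w≢u refl = fw≢fv fu≡fv
  v≢u : v ≢ u
  v≢u refl = v∉K u∈K
  fv<fw : toℕ (f v) < toℕ (f w)
  fv<fw = ≤∧≢⇒< (subst (λ c → toℕ c ≤ toℕ (f w)) fu≡fv (max u∈K)) (fw≢fv ∘ ≡-sym ∘ toℕ-injective)

module SplitColouring (G : Graph n) {K I : Subset n}
  (clique : IsClique G K) (indep : IsIndependent G I)
  (cover : ∀ x → x ∈ K ⊎ x ∈ I) (disjoint : ∀ x → x ∈ K → x ∈ I → ⊥)
  {f : Fin n → Fin k} (rsColouring : IsRSColouring G k f) where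

  proper : ∀ x y → Adj G x y → f x ≢ f y
  proper = proj₁ rsColouring

  ∈I⇒∉K : ∀ {v} → v ∈ I → v ∉ K
  ∈I⇒∉K {v} v∈I v∈K = disjoint v v∈K v∈I

  fresh-colour-bound : ∀ {v} → v ∈ I → (∀ {u} → u ∈ K → f u ≢ f v) → n ∸ ∣ I ∣ < k
  fresh-colour-bound v∈I fresh =
    ≤-<-trans (n∸∣q∣≤∣p∣ cover) (fresh-colour⇒∣K∣<k G clique proper (∈I⇒∉K v∈I) fresh)

  shared-colours-bound : Fin n → (∀ {v} → v ∈ I → ∃ λ u → u ∈ K × f u ≡ f v) →
    ∃ λ S → IsIndependent G S × n ∸ ∣ S ∣ < k
  shared-colours-bound x₀ partner with argmax (toℕ ∘ f) K-nonempty
    where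
    K-nonempty : Nonempty K
    K-nonempty with cover x₀
    ... | inj₁ x₀∈K = x₀ , x₀∈K
    ... | inj₂ x₀∈I = let (u , u∈K , _) = partner x₀∈I in u , u∈K
  ... | w , w∈K , max = I ∪ ⁅ w ⁆ , independent-∪⁅x⁆ G indep w≁I , bound
    where
    w≁I : ∀ v → v ∈ I → ¬ Adj G w v
    w≁I v v∈I = let (u , u∈K , fu≡fv) = partner v∈I in
      maxColour-nonadjacent G clique rsColouring w∈K max u∈K (∈I⇒∉K v∈I) fu≡fv
    bound : n ∸ ∣ I ∪ ⁅ w ⁆ ∣ < k
    bound = <-≤-trans (∸-monoʳ-< (∣p∣<∣p∪⁅x⁆∣ {p = I} (disjoint w w∈K)) (∣p∣≤n (I ∪ ⁅ w ⁆)))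
              (≤-trans (n∸∣q∣≤∣p∣ cover)
                       (injectiveOn⇒∣p∣≤n f K (clique-injectiveOn G clique proper)))

  bound : Fin n → ∃ λ S → IsIndependent G S × n ∸ ∣ S ∣ < k
  bound x₀ with any? (λ v → v ∈? I ×-dec ¬? (any? λ u → u ∈? K ×-dec f u ≟ f v))
  ... | yes (v , v∈I , unused) =
    I , indep , fresh-colour-bound v∈I λ u∈K fu≡fv → unused (_ , u∈K , fu≡fv)
  ... | no ¬unused = shared-colours-bound x₀ partner
    where
    partner : ∀ {v} → v ∈ I → ∃ λ u → u ∈ K × f u ≡ f v
    partner {v} v∈I with any? (λ u → u ∈? K ×-dec f u ≟ f v)
    ... | yes found = found
    ... | no ¬found = contradiction (v , v∈I , ¬found) ¬unused

-- The vertex only witnesses n ≥ 1: for n = 0 the empty colouring (k = 0) violates the bound.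
split-rsColouring-bound : (G : Graph n) → Fin n → IsSplit G → HasRSColouring G k →
  ∃ λ S → IsIndependent G S × n ∸ ∣ S ∣ < k
split-rsColouring-bound G x₀ (K , I , clique , indep , cover , disjoint) (f , rsColouring) =
  SplitColouring.bound G clique indep cover disjoint rsColouring x₀

theorem7 : (n : ℕ) → 1 ≤ n → (G : Graph n) → IsSplit G →
    (a : ℕ) → IsIndependenceNumber G a →
    IsRSChromaticNumber G (n ∸ a + 1)
theorem7 n 1≤n G split a ((S , indep , ∣S∣≡a) , maximum) = upper , lower
  where
  upper : HasRSColouring G (n ∸ a + 1)
  upper = subst (λ c → HasRSColouring G (c + 1)) (trans (∣∁p∣≡n∸∣p∣ S) (cong (n ∸_) ∣S∣≡a))
            (independent⇒rsColouring G indep)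
  lower : ∀ k → k < n ∸ a + 1 → ¬ HasRSColouring G k
  lower k k<n∸a+1 colouring with split-rsColouring-bound G (fromℕ< 1≤n) split colouring
  ... | S′ , indep′ , n∸∣S′∣<k =
    <⇒≱ (≤-<-trans (∸-monoʳ-≤ n (maximum S′ indep′)) n∸∣S′∣<k)
        (s≤s⁻¹ (subst (k <_) (+-comm (n ∸ a) 1) k<n∸a+1))
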